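{- Let $r\ge s\ge0$ be integers, $n=2(r+s)$, and let $G(r,s)$ be the Cayley graph on $\mathbb{Z}_4^n$ whose connection set is the set of vectors of type $(r,s,r,s)$. Then the eigenvalue $\lambda(0,1,n-2,1)$ of $G(r,s)$ equals $-\frac{\binom{n}{r,s,r,s}}{n-1}$.
   Context: For $\mathbf{v}\in\mathbb{Z}_4^n$, its type is $(t_0,t_1,t_2,t_3)$ where $t_k$ is the number of coordinates equal to $k$. For $\mathbf{v}$ of type $(t_0,t_1,t_2,t_3)$, $\lambda(t_0,t_1,t_2,t_3)=\lambda(\mathbf{v})=\sum_{\mathbf{b}}\zeta_4^{\mathbf{b}\cdot\mathbf{v}}$, where $\mathbf{b}$ ranges over vectors of type $(r,s,r,s)$, $\zeta_4=\sqrt{ -1}$ and $\mathbf{b}\cdot\mathbf{v}=\sum_kb_kv_k\in\mathbb{Z}_4$; this is an eigenvalue of $G(r,s)$ depending only on the type of $\mathbf{v}$. $\binom{n}{r,s,r,s}=\frac{n!}{(r!)^2(s!)^2}$. -}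

module Defs where

open import Data.Nat using (ℕ; zero; suc; _+_; _*_; _≡ᵇ_)
open import Data.Integer as ℤ using (ℤ; +_; -[1+_])
open import Data.Fin using (Fin; toℕ)
open import Data.Fin.Properties using (_≟_)
open import Data.Vec using (Vec; []; _∷_; count)
open import Data.List as L using (List; [_]; concatMap; filterᵇ; foldr; allFin)
open import Data.Product using (_×_; _,_)
open import Data.Bool using (Bool; _∧_)

-- Gaussian integers a + b i represented as pairs (a , b) of integers.
GInt : Set
GInt = ℤ × ℤ

_+ᴳ_ : GInt → GInt → GInt
(a , b) +ᴳ (c , d) = (a ℤ.+ c , b ℤ.+ d)

0ᴳ : GInt
0ᴳ = (+ 0 , + 0)

ζ^ : ℕ → GInt
ζ^ 0 = (+ 1 , + 0)
ζ^ 1 = (+ 0 , + 1)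
ζ^ 2 = (-[1+ 0 ] , + 0)
ζ^ 3 = (+ 0 , -[1+ 0 ])
ζ^ (suc (suc (suc (suc m)))) = ζ^ m

Z4Vec : ℕ → Set
Z4Vec n = Vec (Fin 4) n

allZ4 : (n : ℕ) → List (Z4Vec n)
allZ4 zero = [ [] ]
allZ4 (suc n) = concatMap (λ x → L.map (x ∷_) (allZ4 n)) (allFin 4)

tcount : ∀ {n} → Fin 4 → Z4Vec n → ℕ
tcount k v = count (_≟ k) v

hasTypeᵇ : ∀ {n} → Z4Vec n → ℕ → ℕ → ℕ → ℕ → Bool
hasTypeᵇ v t0 t1 t2 t3 =
  (tcount Fin.zero v ≡ᵇ t0) ∧ (tcount (Fin.suc Fin.zero) v ≡ᵇ t1)
  ∧ (tcount (Fin.suc (Fin.suc Fin.zero)) v ≡ᵇ t2)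
  ∧ (tcount (Fin.suc (Fin.suc (Fin.suc Fin.zero))) v ≡ᵇ t3)
  where import Data.Fin as Fin

HasType : ∀ {n} → Z4Vec n → ℕ → ℕ → ℕ → ℕ → Set
HasType v t0 t1 t2 t3 = hasTypeᵇ v t0 t1 t2 t3 ≡ Bool.true
  where open import Relation.Binary.PropositionalEquality using (_≡_)
        import Data.Bool as Bool

-- b · v as a natural number (its residue mod 4 is the ℤ₄ value; ζ^ only depends on it)
dot : ∀ {n} → Z4Vec n → Z4Vec n → ℕ
dot [] [] = 0
dot (b ∷ bs) (v ∷ vs) = toℕ b * toℕ v + dot bs vs

connSet : (n r s : ℕ) → List (Z4Vec n)
connSet n r s = filterᵇ (λ b → hasTypeᵇ b r s r s) (allZ4 n)

eigen : (r s : ℕ) → ∀ {n} → Z4Vec n → GInt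
eigen r s {n} v = foldr (λ b acc → ζ^ (dot b v) +ᴳ acc) 0ᴳ (connSet n r s)

module Submission where

-- Write λ_c(v) = Σ ζ₄^(b·v) over the vectors b of type c.  Splitting off the first
-- coordinate y of b gives λ_c(x ∷ v) = Σ_y ζ₄^(xy) λ_{c − e_y}(v); applying this twice
-- shows that λ_c(v) is unchanged when two adjacent coordinates of v are swapped, so it
-- depends only on the type of v and we may take v = 1 3 2 ⋯ 2.  Since b·(2, …, 2) is
-- 2 Σᵢ i cᵢ, the factor ζ₄^(2 Σᵢ i cᵢ), which is 1 for c = (r, s, r, s), passes through
-- the recursion, leaving λ = Σ_{a,b} ζ₄^(3a + b) N_ab where N_ab counts the vectors of
-- type c beginning with a b, and N_ab ∏ᵢ cᵢ! = c_a (c − e_a)_b (n − 2)!.  The imaginary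
-- part cancels because N_ab = N_ba, and ∏ᵢ cᵢ! times the real part is
-- (n − 2)! Σ_a (c_a (c_a − 1) − c_a c_{a+2}) = − n (n − 2)!.

open import Defs
open import Data.Nat using (ℕ; _+_; _*_; _∸_; _≤_; _!)
open import Data.Integer as ℤ using (ℤ; +_; -_)
open import Data.Product using (_×_; _,_; proj₁; proj₂)
open import Relation.Binary.PropositionalEquality using (_≡_)

open import Algebra.Bundles using (CommutativeMonoid)
open import Algebra.Structures using (IsCommutativeMonoid)
import Algebra.Properties.CommutativeMonoid.Sum as MonoidSum
import Algebra.Properties.Semiring.Sum as SemiringSum
open import Data.Bool using (Bool; true; false; T; T?; _∧_)
open import Data.Bool.Properties using (∧-zeroʳ; ∧-conicalˡ; ∧-conicalʳ)
open import Data.Fin as Fin using (Fin; toℕ; _≟_)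
open import Data.Fin.Patterns using (0F; 1F; 2F; 3F)
open import Data.List as List using (List; []; _∷_; _++_; concatMap; filterᵇ; foldr)
open import Data.List.Properties using (filter-++; filter-≐; filter-none; foldr-map; foldr-cong)
import Data.List.Relation.Unary.All as All
open import Data.Nat using (zero; suc; pred; _≡ᵇ_)
import Data.Nat.Properties as ℕP
open import Algebra.Properties.CommutativeSemigroup ℕP.*-commutativeSemigroup using (x∙yz≈y∙xz)
open import Data.Nat.Tactic.RingSolver using (solve-∀)
import Data.Integer.Properties as ℤP
import Data.Integer.Tactic.RingSolver as ℤSolver
open import Data.Unit using (tt)
open import Data.Vec as Vec using (Vec; []; _∷_; lookup; updateAt; replicate)
open import Data.Vec.Properties using (updateAt-commutes; lookup∘updateAt′)
open import Function using (_∘_)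
open import Level using (0ℓ)
open import Relation.Nullary using (yes; no)
open import Relation.Binary.PropositionalEquality
  using (refl; sym; trans; cong; cong₂; subst; isEquivalence; module ≡-Reasoning)

open ≡-Reasoning

private
  variable
    A B : Set

-- Gaussian integers

rot : GInt → GInt
rot (a , b) = (- b , a)

rot^ : ℕ → GInt → GInt
rot^ zero    z = z
rot^ (suc m) z = rot (rot^ m z)

real : ℕ → GInt
real n = (+ n , + 0)

+ᴳ-assoc : ∀ x y z → (x +ᴳ y) +ᴳ z ≡ x +ᴳ (y +ᴳ z)
+ᴳ-assoc (a , b) (c , d) (e , f) = cong₂ _,_ (ℤP.+-assoc a c e) (ℤP.+-assoc b d f)

+ᴳ-comm : ∀ x y → x +ᴳ y ≡ y +ᴳ x
+ᴳ-comm (a , b) (c , d) = cong₂ _,_ (ℤP.+-comm a c) (ℤP.+-comm b d)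

+ᴳ-identityˡ : ∀ x → 0ᴳ +ᴳ x ≡ x
+ᴳ-identityˡ (a , b) = cong₂ _,_ (ℤP.+-identityˡ a) (ℤP.+-identityˡ b)

+ᴳ-identityʳ : ∀ x → x +ᴳ 0ᴳ ≡ x
+ᴳ-identityʳ (a , b) = cong₂ _,_ (ℤP.+-identityʳ a) (ℤP.+-identityʳ b)

+ᴳ-isCommutativeMonoid : IsCommutativeMonoid _≡_ _+ᴳ_ 0ᴳ
+ᴳ-isCommutativeMonoid = record
  { isMonoid = record
    { isSemigroup = record
      { isMagma = record { isEquivalence = isEquivalence ; ∙-cong = cong₂ _+ᴳ_ }
      ; assoc = +ᴳ-assoc
      }
    ; identity = +ᴳ-identityˡ , +ᴳ-identityʳ
    }
  ; comm = +ᴳ-comm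
  }

+ᴳ-commutativeMonoid : CommutativeMonoid 0ℓ 0ℓ
+ᴳ-commutativeMonoid = record { isCommutativeMonoid = +ᴳ-isCommutativeMonoid }

module Σᴳ = MonoidSum +ᴳ-commutativeMonoid
module Σℕ = SemiringSum ℕP.+-*-semiring

rot-+ᴳ : ∀ z w → rot (z +ᴳ w) ≡ rot z +ᴳ rot w
rot-+ᴳ (a , b) (c , d) = cong (_, a ℤ.+ c) (ℤP.neg-distrib-+ b d)

rot⁴ : ∀ z → rot (rot (rot (rot z))) ≡ z
rot⁴ (a , b) = cong₂ _,_ (ℤP.neg-involutive a) (ℤP.neg-involutive b)

ζ^-suc : ∀ m → ζ^ (suc m) ≡ rot (ζ^ m)
ζ^-suc 0 = refl
ζ^-suc 1 = refl
ζ^-suc 2 = refl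
ζ^-suc 3 = refl
ζ^-suc (suc (suc (suc (suc m)))) = ζ^-suc m

ζ^-+ : ∀ m n → ζ^ (m + n) ≡ rot^ m (ζ^ n)
ζ^-+ zero    n = refl
ζ^-+ (suc m) n = trans (ζ^-suc (m + n)) (cong rot (ζ^-+ m n))

rot^-0ᴳ : ∀ m → rot^ m 0ᴳ ≡ 0ᴳ
rot^-0ᴳ zero    = refl
rot^-0ᴳ (suc m) = cong rot (rot^-0ᴳ m)

rot^-+ᴳ : ∀ m z w → rot^ m (z +ᴳ w) ≡ rot^ m z +ᴳ rot^ m w
rot^-+ᴳ zero    z w = refl
rot^-+ᴳ (suc m) z w = trans (cong rot (rot^-+ᴳ m z w)) (rot-+ᴳ (rot^ m z) (rot^ m w))

rot^-+ : ∀ m n z → rot^ (m + n) z ≡ rot^ m (rot^ n z)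
rot^-+ zero    n z = refl
rot^-+ (suc m) n z = cong rot (rot^-+ m n z)

rot^-comm : ∀ m n z → rot^ m (rot^ n z) ≡ rot^ n (rot^ m z)
rot^-comm m n z = begin
  rot^ m (rot^ n z) ≡⟨ rot^-+ m n z ⟨
  rot^ (m + n) z    ≡⟨ cong (λ e → rot^ e z) (ℕP.+-comm m n) ⟩
  rot^ (n + m) z    ≡⟨ rot^-+ n m z ⟩
  rot^ n (rot^ m z) ∎

rot^-*4 : ∀ q z → rot^ (q * 4) z ≡ z
rot^-*4 zero    z = refl
rot^-*4 (suc q) z = trans (rot⁴ (rot^ (q * 4) z)) (rot^-*4 q z)

rot^-sum : ∀ {n} m (f : Fin n → GInt) → rot^ m (Σᴳ.sum f) ≡ Σᴳ.sum (rot^ m ∘ f)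
rot^-sum {zero}  m f = rot^-0ᴳ m
rot^-sum {suc n} m f =
  trans (rot^-+ᴳ m (f 0F) _) (cong (rot^ m (f 0F) +ᴳ_) (rot^-sum m (f ∘ Fin.suc)))

-- x ζ₄^m with both components written out, so that sums of such terms compute to
-- ring expressions in the x's
infix 5 _·ζ^_
_·ζ^_ : ℤ → ℕ → GInt
x ·ζ^ 0 = (x , + 0)
x ·ζ^ 1 = (+ 0 , x)
x ·ζ^ 2 = (- x , + 0)
x ·ζ^ 3 = (+ 0 , - x)
x ·ζ^ suc (suc (suc (suc m))) = x ·ζ^ m

rot^-real : ∀ m n → rot^ m (real n) ≡ (+ n) ·ζ^ m
rot^-real zero    n = refl
rot^-real (suc m) n = trans (cong rot (rot^-real m n)) (rot-·ζ^ m)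
  where
  rot-·ζ^ : ∀ m → rot ((+ n) ·ζ^ m) ≡ (+ n) ·ζ^ suc m
  rot-·ζ^ 0 = refl
  rot-·ζ^ 1 = refl
  rot-·ζ^ 2 = refl
  rot-·ζ^ 3 = cong (_, + 0) (ℤP.neg-involutive (+ n))
  rot-·ζ^ (suc (suc (suc (suc m)))) = rot-·ζ^ m

sumᴳ : (A → GInt) → List A → GInt
sumᴳ f = foldr (λ x → f x +ᴳ_) 0ᴳ

sumᴳ-map : ∀ (f : B → GInt) (h : A → B) xs → sumᴳ f (List.map h xs) ≡ sumᴳ (f ∘ h) xs
sumᴳ-map f h = foldr-map (λ x → f x +ᴳ_) h 0ᴳ

sumᴳ-cong : ∀ {f g : A → GInt} → (∀ x → f x ≡ g x) → ∀ xs → sumᴳ f xs ≡ sumᴳ g xs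
sumᴳ-cong f≗g = foldr-cong (λ x _ → cong (_+ᴳ _) (f≗g x)) refl

sumᴳ-++ : ∀ (f : A → GInt) xs ys → sumᴳ f (xs ++ ys) ≡ sumᴳ f xs +ᴳ sumᴳ f ys
sumᴳ-++ f []       ys = sym (+ᴳ-identityˡ _)
sumᴳ-++ f (x ∷ xs) ys = trans (cong (f x +ᴳ_) (sumᴳ-++ f xs ys)) (sym (+ᴳ-assoc (f x) _ _))

sumᴳ-concatMap : ∀ (f : A → GInt) (g : B → List A) xs →
                 sumᴳ f (concatMap g xs) ≡ sumᴳ (sumᴳ f ∘ g) xs
sumᴳ-concatMap f g []       = refl
sumᴳ-concatMap f g (x ∷ xs) =
  trans (sumᴳ-++ f (g x) _) (cong (sumᴳ f (g x) +ᴳ_) (sumᴳ-concatMap f g xs))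

sumᴳ-rot^ : ∀ m (f : A → GInt) xs → rot^ m (sumᴳ f xs) ≡ sumᴳ (rot^ m ∘ f) xs
sumᴳ-rot^ m f []       = rot^-0ᴳ m
sumᴳ-rot^ m f (x ∷ xs) =
  trans (rot^-+ᴳ m (f x) _) (cong (rot^ m (f x) +ᴳ_) (sumᴳ-rot^ m f xs))

filterᵇ-concatMap : ∀ (p : A → Bool) (g : B → List A) xs →
                    filterᵇ p (concatMap g xs) ≡ concatMap (filterᵇ p ∘ g) xs
filterᵇ-concatMap p g []       = refl
filterᵇ-concatMap p g (x ∷ xs) =
  trans (filter-++ (T? ∘ p) (g x) _) (cong (filterᵇ p (g x) ++_) (filterᵇ-concatMap p g xs))

filterᵇ-map : ∀ (p : B → Bool) (h : A → B) xs →
              filterᵇ p (List.map h xs) ≡ List.map h (filterᵇ (p ∘ h) xs)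
filterᵇ-map p h []       = refl
filterᵇ-map p h (x ∷ xs) with p (h x)
... | true  = cong (h x ∷_) (filterᵇ-map p h xs)
... | false = filterᵇ-map p h xs

filterᵇ-cong : ∀ {p q : A → Bool} → (∀ x → p x ≡ q x) → ∀ xs → filterᵇ p xs ≡ filterᵇ q xs
filterᵇ-cong {p = p} {q} p≗q =
  filter-≐ (T? ∘ p) (T? ∘ q) ((λ {x} → subst T (p≗q x)) , (λ {x} → subst T (sym (p≗q x))))

filterᵇ-false : ∀ (xs : List A) → filterᵇ (λ _ → false) xs ≡ []
filterᵇ-false xs = filter-none (T? ∘ λ _ → false) (All.universal (λ _ ()) xs)

ifPos : ℕ → A → A → A
ifPos zero    _ z = z
ifPos (suc _) x _ = x

remove : ∀ {n} → Fin n → Vec ℕ n → Vec ℕ n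
remove y c = updateAt c y pred

-- g at c − e_y, or z when c has no y to remove (remove truncates at 0)
peel : ∀ {n} → A → Fin n → (Vec ℕ n → A) → Vec ℕ n → A
peel z y g c = ifPos (lookup c y) (g (remove y c)) z

peel-cong : ∀ {n} (z : A) y {g h : Vec ℕ n → A} → (∀ c → g c ≡ h c) →
            ∀ c → peel z y g c ≡ peel z y h c
peel-cong z y g≗h c = cong (λ x → ifPos (lookup c y) x z) (g≗h (remove y c))

peel-natural : ∀ {n} (f : A → B) (z : A) y (g : Vec ℕ n → A) c →
               f (peel z y g c) ≡ peel (f z) y (f ∘ g) c
peel-natural f z y g c with lookup c y
... | zero  = refl
... | suc _ = refl

peel-comm : ∀ {n} (z : A) a b (g : Vec ℕ n → A) c →
            peel z a (peel z b g) c ≡ peel z b (peel z a g) c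
peel-comm z a b g c with a ≟ b
... | yes refl = refl
... | no a≢b = begin
  ifPos (lookup c a) (ifPos (lookup (remove a c) b) (g (remove b (remove a c))) z) z
    ≡⟨ cong₂ (λ l d → ifPos (lookup c a) (ifPos l (g d) z) z)
             (lookup∘updateAt′ b a (a≢b ∘ sym) c) (updateAt-commutes b a (a≢b ∘ sym) c) ⟩
  ifPos (lookup c a) (ifPos (lookup c b) (g (remove a (remove b c))) z) z
    ≡⟨ ifPos-comm (lookup c a) (lookup c b) ⟩
  ifPos (lookup c b) (ifPos (lookup c a) (g (remove a (remove b c))) z) z
    ≡⟨ cong (λ l → ifPos (lookup c b) (ifPos l (g (remove a (remove b c))) z) z)
            (lookup∘updateAt′ a b a≢b c) ⟨
  ifPos (lookup c b) (ifPos (lookup (remove b c) a) (g (remove a (remove b c))) z) z ∎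
  where
  ifPos-comm : ∀ k l {x} → ifPos k (ifPos l x z) z ≡ ifPos l (ifPos k x z) z
  ifPos-comm zero    zero    = refl
  ifPos-comm zero    (suc _) = refl
  ifPos-comm (suc _) zero    = refl
  ifPos-comm (suc _) (suc _) = refl

size : ∀ {n} → Vec ℕ n → ℕ
size c = Σℕ.sum (lookup c)

-- Σᵢ i cᵢ, the coordinate sum of every vector of type c
weight : ∀ {n} → Vec ℕ n → ℕ
weight []      = 0
weight (_ ∷ c) = size c + weight c

∏! : ∀ {n} → Vec ℕ n → ℕ
∏! []      = 1
∏! (t ∷ c) = t ! * ∏! c

module _ {j : ℕ} where

  size-remove : ∀ {n} (y : Fin n) c → lookup c y ≡ suc j → size c ≡ suc (size (remove y c))
  size-remove 0F            (t ∷ c) refl = refl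
  size-remove (Fin.suc y)   (t ∷ c) c[y]≡1+j =
    trans (cong (λ s → t + s) (size-remove y c c[y]≡1+j)) (ℕP.+-suc t _)

  weight-remove : ∀ {n} (y : Fin n) c → lookup c y ≡ suc j → toℕ y + weight (remove y c) ≡ weight c
  weight-remove 0F          (t ∷ c) refl = refl
  weight-remove (Fin.suc y) (t ∷ c) c[y]≡1+j = begin
    suc (toℕ y) + (size (remove y c) + weight (remove y c))
      ≡⟨ shuffle (toℕ y) (size (remove y c)) (weight (remove y c)) ⟩
    suc (size (remove y c)) + (toℕ y + weight (remove y c))
      ≡⟨ cong₂ _+_ (sym (size-remove y c c[y]≡1+j)) (weight-remove y c c[y]≡1+j) ⟩
    size c + weight c ∎
    where
    shuffle : ∀ a b w → suc a + (b + w) ≡ suc b + (a + w)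
    shuffle = solve-∀

  ∏!-remove : ∀ {n} (y : Fin n) c → lookup c y ≡ suc j → ∏! c ≡ suc j * ∏! (remove y c)
  ∏!-remove 0F          (t ∷ c) refl = ℕP.*-assoc (suc j) (j !) (∏! c)
  ∏!-remove (Fin.suc y) (t ∷ c) c[y]≡1+j = begin
    t ! * ∏! c                         ≡⟨ cong (t ! *_) (∏!-remove y c c[y]≡1+j) ⟩
    t ! * (suc j * ∏! (remove y c))    ≡⟨ x∙yz≈y∙xz (t !) (suc j) _ ⟩
    suc j * (t ! * ∏! (remove y c))    ∎

multinomial : ∀ {n} → ℕ → Vec ℕ n → ℕ
multinomial zero    []          = 1
multinomial zero    (zero ∷ c)  = multinomial zero c
multinomial zero    (suc _ ∷ _) = 0
multinomial (suc k) c           = Σℕ.sum (λ y → peel 0 y (multinomial k) c)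

peel-∏! : ∀ {n k} {g h : Vec ℕ n → ℕ} → (∀ c → size c ≡ k → g c * ∏! c ≡ h c) →
          ∀ y c → size c ≡ suc k → peel 0 y g c * ∏! c ≡ lookup c y * h (remove y c)
peel-∏! {n} {k} {g} {h} g∏!≡h y c size≡ with lookup c y in c[y]≡
... | zero  = refl
... | suc j = begin
  g c' * ∏! c                ≡⟨ cong (g c' *_) (∏!-remove y c c[y]≡) ⟩
  g c' * (suc j * ∏! c')     ≡⟨ x∙yz≈y∙xz (g c') (suc j) (∏! c') ⟩
  suc j * (g c' * ∏! c')     ≡⟨ cong (suc j *_) (g∏!≡h c' size′≡) ⟩
  suc j * h c'               ∎
  where
  c' : Vec ℕ n
  c' = remove y c
  size′≡ : size c' ≡ k
  size′≡ = ℕP.suc-injective (trans (sym (size-remove y c c[y]≡)) size≡)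

multinomial-! : ∀ {n} k (c : Vec ℕ n) → size c ≡ k → multinomial k c * ∏! c ≡ k !
multinomial-! zero    []          _    = refl
multinomial-! zero    (zero ∷ c)  size≡ =
  trans (cong (multinomial zero c *_) (ℕP.+-identityʳ (∏! c))) (multinomial-! zero c size≡)
multinomial-! zero    (suc _ ∷ _) ()
multinomial-! (suc k) c           size≡ = begin
  Σℕ.sum (λ y → peel 0 y (multinomial k) c) * ∏! c
    ≡⟨ Σℕ.*-distribʳ-sum (∏! c) (λ y → peel 0 y (multinomial k) c) ⟩
  Σℕ.sum (λ y → peel 0 y (multinomial k) c * ∏! c)
    ≡⟨ Σℕ.sum-cong-≗ (λ y → peel-∏! {g = multinomial k} (λ c′ → multinomial-! k c′) y c size≡) ⟩
  Σℕ.sum (λ y → lookup c y * k !)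
    ≡⟨ Σℕ.*-distribʳ-sum (k !) (lookup c) ⟨
  size c * k !
    ≡⟨ cong (_* k !) size≡ ⟩
  suc k * k ! ∎

-- Character sums

Counts : Set
Counts = Vec ℕ 4

hasType : ∀ {n} → Counts → Z4Vec n → Bool
hasType (t₀ ∷ t₁ ∷ t₂ ∷ t₃ ∷ []) b = hasTypeᵇ b t₀ t₁ t₂ t₃

-- λ(v) of the paper for the connection set of type c; eigen r s v is by definition
-- charSum v (r ∷ s ∷ r ∷ s ∷ [])
charSum : ∀ {n} → Z4Vec n → Counts → GInt
charSum {n} v c = sumᴳ (λ b → ζ^ (dot b v)) (filterᵇ (hasType c) (allZ4 n))

hasType-∷ : ∀ {n} y (b : Z4Vec n) c → hasType c (y ∷ b) ≡ peel false y (λ c' → hasType c' b) c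
hasType-∷ 0F b (zero  ∷ _ ∷ _ ∷ _ ∷ []) = refl
hasType-∷ 0F b (suc _ ∷ _ ∷ _ ∷ _ ∷ []) = refl
hasType-∷ 1F b (t₀ ∷ zero  ∷ _ ∷ _ ∷ []) = ∧-zeroʳ (tcount 0F b ≡ᵇ t₀)
hasType-∷ 1F b (_ ∷ suc _ ∷ _ ∷ _ ∷ []) = refl
hasType-∷ 2F b (t₀ ∷ t₁ ∷ zero  ∷ _ ∷ []) =
  trans (cong ((tcount 0F b ≡ᵇ t₀) ∧_) (∧-zeroʳ (tcount 1F b ≡ᵇ t₁))) (∧-zeroʳ _)
hasType-∷ 2F b (_ ∷ _ ∷ suc _ ∷ _ ∷ []) = refl
hasType-∷ 3F b (t₀ ∷ t₁ ∷ t₂ ∷ zero ∷ []) =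
  trans (cong ((tcount 0F b ≡ᵇ t₀) ∧_)
              (trans (cong ((tcount 1F b ≡ᵇ t₁) ∧_) (∧-zeroʳ (tcount 2F b ≡ᵇ t₂))) (∧-zeroʳ _)))
        (∧-zeroʳ _)
hasType-∷ 3F b (_ ∷ _ ∷ _ ∷ suc _ ∷ []) = refl

filterᵇ-hasType-∷ : ∀ {n} y (bs : List (Z4Vec n)) c →
  filterᵇ (hasType c ∘ (y ∷_)) bs ≡ peel [] y (λ c' → filterᵇ (hasType c') bs) c
filterᵇ-hasType-∷ y bs c = trans (filterᵇ-cong (λ b → hasType-∷ y b c) bs) (filter-peel c)
  where
  filter-peel : ∀ c → filterᵇ (λ b → peel false y (λ c' → hasType c' b) c) bs
                      ≡ peel [] y (λ c' → filterᵇ (hasType c') bs) c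
  filter-peel c with lookup c y
  ... | zero  = filterᵇ-false bs
  ... | suc _ = refl

charSum-block : ∀ {n} x (v : Z4Vec n) y c →
  sumᴳ (λ b → ζ^ (dot b (x ∷ v))) (filterᵇ (hasType c) (List.map (y ∷_) (allZ4 n)))
    ≡ rot^ (toℕ y * toℕ x) (peel 0ᴳ y (charSum v) c)
charSum-block {n} x v y c = begin
  sumᴳ f (filterᵇ (hasType c) (List.map (y ∷_) (allZ4 n)))
    ≡⟨ cong (sumᴳ f) (filterᵇ-map (hasType c) (y ∷_) (allZ4 n)) ⟩
  sumᴳ f (List.map (y ∷_) bs)
    ≡⟨ sumᴳ-map f (y ∷_) bs ⟩
  sumᴳ (λ b → ζ^ (toℕ y * toℕ x + dot b v)) bs
    ≡⟨ sumᴳ-cong (λ b → ζ^-+ (toℕ y * toℕ x) (dot b v)) bs ⟩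
  sumᴳ (rot^ (toℕ y * toℕ x) ∘ g) bs
    ≡⟨ sumᴳ-rot^ (toℕ y * toℕ x) g bs ⟨
  rot^ (toℕ y * toℕ x) (sumᴳ g bs)
    ≡⟨ cong (rot^ (toℕ y * toℕ x) ∘ sumᴳ g) (filterᵇ-hasType-∷ y (allZ4 n) c) ⟩
  rot^ (toℕ y * toℕ x) (sumᴳ g (peel [] y byType c))
    ≡⟨ cong (rot^ (toℕ y * toℕ x)) (peel-natural (sumᴳ g) [] y byType c) ⟩
  rot^ (toℕ y * toℕ x) (peel 0ᴳ y (charSum v) c) ∎
  where
  f : Z4Vec (suc n) → GInt
  f b = ζ^ (dot b (x ∷ v))
  g : Z4Vec n → GInt
  g b = ζ^ (dot b v)
  bs : List (Z4Vec n)
  bs = filterᵇ (hasType c ∘ (y ∷_)) (allZ4 n)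
  byType : Counts → List (Z4Vec n)
  byType c' = filterᵇ (hasType c') (allZ4 n)

charSum-∷ : ∀ {n} x (v : Z4Vec n) c →
  charSum (x ∷ v) c ≡ Σᴳ.sum (λ y → rot^ (toℕ y * toℕ x) (peel 0ᴳ y (charSum v) c))
charSum-∷ {n} x v c = begin
  sumᴳ f (filterᵇ (hasType c) (concatMap block (List.allFin 4)))
    ≡⟨ cong (sumᴳ f) (filterᵇ-concatMap (hasType c) block (List.allFin 4)) ⟩
  sumᴳ f (concatMap (filterᵇ (hasType c) ∘ block) (List.allFin 4))
    ≡⟨ sumᴳ-concatMap f (filterᵇ (hasType c) ∘ block) (List.allFin 4) ⟩
  Σᴳ.sum (λ y → sumᴳ f (filterᵇ (hasType c) (block y)))
    ≡⟨ Σᴳ.sum-cong-≗ (λ y → charSum-block x v y c) ⟩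
  Σᴳ.sum (λ y → rot^ (toℕ y * toℕ x) (peel 0ᴳ y (charSum v) c)) ∎
  where
  block : Fin 4 → List (Z4Vec (suc n))
  block y = List.map (y ∷_) (allZ4 n)
  f : Z4Vec (suc n) → GInt
  f b = ζ^ (dot b (x ∷ v))

peel-sum : ∀ {m n} y (f : Fin m → Vec ℕ n → GInt) c →
           peel 0ᴳ y (λ c' → Σᴳ.sum (λ b → f b c')) c ≡ Σᴳ.sum (λ b → peel 0ᴳ y (f b) c)
peel-sum {m} y f c with lookup c y
... | zero  = sym (Σᴳ.sum-replicate-zero m)
... | suc _ = refl

peel-rot^ : ∀ {n} m y (g : Vec ℕ n → GInt) c → peel 0ᴳ y (rot^ m ∘ g) c ≡ rot^ m (peel 0ᴳ y g c)
peel-rot^ m y g c =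
  trans (cong (λ z → peel z y (rot^ m ∘ g) c) (sym (rot^-0ᴳ m))) (sym (peel-natural (rot^ m) 0ᴳ y g c))

double-peel : ∀ {n} (e e′ : Fin n → ℕ) (H : Vec ℕ n → GInt) c →
  Σᴳ.sum (λ a → rot^ (e a) (peel 0ᴳ a (λ c' → Σᴳ.sum (λ b → rot^ (e′ b) (peel 0ᴳ b H c'))) c))
    ≡ Σᴳ.sum (λ a → Σᴳ.sum (λ b → rot^ (e a) (rot^ (e′ b) (peel 0ᴳ a (peel 0ᴳ b H) c))))
double-peel e e′ H c = Σᴳ.sum-cong-≗ λ a → begin
  rot^ (e a) (peel 0ᴳ a (λ c' → Σᴳ.sum (λ b → rot^ (e′ b) (peel 0ᴳ b H c'))) c)
    ≡⟨ cong (rot^ (e a)) (peel-sum a (λ b → rot^ (e′ b) ∘ peel 0ᴳ b H) c) ⟩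
  rot^ (e a) (Σᴳ.sum (λ b → peel 0ᴳ a (rot^ (e′ b) ∘ peel 0ᴳ b H) c))
    ≡⟨ rot^-sum (e a) (λ b → peel 0ᴳ a (rot^ (e′ b) ∘ peel 0ᴳ b H) c) ⟩
  Σᴳ.sum (λ b → rot^ (e a) (peel 0ᴳ a (rot^ (e′ b) ∘ peel 0ᴳ b H) c))
    ≡⟨ Σᴳ.sum-cong-≗ (λ b → cong (rot^ (e a)) (peel-rot^ (e′ b) a (peel 0ᴳ b H) c)) ⟩
  Σᴳ.sum (λ b → rot^ (e a) (rot^ (e′ b) (peel 0ᴳ a (peel 0ᴳ b H) c))) ∎

charSum-∷∷ : ∀ {n} x y (v : Z4Vec n) c → charSum (x ∷ y ∷ v) c ≡
  Σᴳ.sum (λ a → Σᴳ.sum (λ b →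
    rot^ (toℕ a * toℕ x) (rot^ (toℕ b * toℕ y) (peel 0ᴳ a (peel 0ᴳ b (charSum v)) c))))
charSum-∷∷ x y v c =
  trans (charSum-∷ x (y ∷ v) c)
        (trans (Σᴳ.sum-cong-≗ λ a → cong (rot^ (toℕ a * toℕ x)) (peel-cong 0ᴳ a (charSum-∷ y v) c))
               (double-peel (λ a → toℕ a * toℕ x) (λ b → toℕ b * toℕ y) (charSum v) c))

-- Dependence on the type of the vector only

infix 4 _≈_
record _≈_ {m n} (u : Z4Vec m) (v : Z4Vec n) : Set where
  constructor mk≈
  field charSum-≡ : ∀ c → charSum u c ≡ charSum v c
open _≈_

≈-refl : ∀ {n} {v : Z4Vec n} → v ≈ v
≈-refl = mk≈ λ c → refl

≈-trans : ∀ {l m n} {u : Z4Vec l} {v : Z4Vec m} {w : Z4Vec n} → u ≈ v → v ≈ w → u ≈ w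
≈-trans u≈v v≈w = mk≈ λ c → trans (charSum-≡ u≈v c) (charSum-≡ v≈w c)

∷-cong : ∀ {m n} x {u : Z4Vec m} {v : Z4Vec n} → u ≈ v → x ∷ u ≈ x ∷ v
∷-cong x {u} {v} u≈v = mk≈ λ c →
  trans (charSum-∷ x u c)
        (trans (Σᴳ.sum-cong-≗ λ y → cong (rot^ (toℕ y * toℕ x)) (peel-cong 0ᴳ y (charSum-≡ u≈v) c))
               (sym (charSum-∷ x v c)))

∷-swap : ∀ {n} x y (v : Z4Vec n) → x ∷ y ∷ v ≈ y ∷ x ∷ v
∷-swap x y v = mk≈ λ c → begin
  charSum (x ∷ y ∷ v) c
    ≡⟨ charSum-∷∷ x y v c ⟩
  Σᴳ.sum (λ a → Σᴳ.sum (λ b → rot^ (toℕ a * toℕ x) (rot^ (toℕ b * toℕ y) (peel 0ᴳ a (peel 0ᴳ b E) c))))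
    ≡⟨ Σᴳ.∑-comm (λ a b → rot^ (toℕ a * toℕ x) (rot^ (toℕ b * toℕ y) (peel 0ᴳ a (peel 0ᴳ b E) c))) ⟩
  Σᴳ.sum (λ b → Σᴳ.sum (λ a → rot^ (toℕ a * toℕ x) (rot^ (toℕ b * toℕ y) (peel 0ᴳ a (peel 0ᴳ b E) c))))
    ≡⟨ Σᴳ.sum-cong-≗ (λ b → Σᴳ.sum-cong-≗ λ a →
         trans (rot^-comm (toℕ a * toℕ x) (toℕ b * toℕ y) (peel 0ᴳ a (peel 0ᴳ b E) c))
               (cong (rot^ (toℕ b * toℕ y) ∘ rot^ (toℕ a * toℕ x)) (peel-comm 0ᴳ a b E c))) ⟩
  Σᴳ.sum (λ b → Σᴳ.sum (λ a → rot^ (toℕ b * toℕ y) (rot^ (toℕ a * toℕ x) (peel 0ᴳ b (peel 0ᴳ a E) c))))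
    ≡⟨ charSum-∷∷ y x v c ⟨
  charSum (y ∷ x ∷ v) c ∎
  where
  E : Counts → GInt
  E = charSum v

∷-++ : ∀ {m n} x (u : Z4Vec m) (w : Z4Vec n) → x ∷ (u Vec.++ w) ≈ u Vec.++ (x ∷ w)
∷-++ x []      w = ≈-refl
∷-++ x (y ∷ u) w = ≈-trans (∷-swap x y (u Vec.++ w)) (∷-cong y (∷-++ x u w))

++-congˡ : ∀ {l m n} (u : Z4Vec l) {v : Z4Vec m} {w : Z4Vec n} → v ≈ w → u Vec.++ v ≈ u Vec.++ w
++-congˡ []      v≈w = v≈w
++-congˡ (x ∷ u) v≈w = ∷-cong x (++-congˡ u v≈w)

-- The blocks are ordered 1, 3, 0, 2 so that the canonical vector of type (0, 1, k, 1) is 1 3 2 ⋯ 2.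
canonical : ∀ t₀ t₁ t₂ t₃ → Z4Vec (t₁ + (t₃ + (t₀ + t₂)))
canonical t₀ t₁ t₂ t₃ =
  replicate t₁ 1F Vec.++ replicate t₃ 3F Vec.++ replicate t₀ 0F Vec.++ replicate t₂ 2F

≈-canonical : ∀ {n} (v : Z4Vec n) →
              v ≈ canonical (tcount 0F v) (tcount 1F v) (tcount 2F v) (tcount 3F v)
≈-canonical []       = ≈-refl
≈-canonical (0F ∷ v) =
  ≈-trans (∷-cong 0F (≈-canonical v))
  (≈-trans (∷-++ 0F ones _) (++-congˡ ones (∷-++ 0F threes _)))
  where
  ones : Z4Vec (tcount 1F v)
  ones = replicate (tcount 1F v) 1F
  threes : Z4Vec (tcount 3F v)
  threes = replicate (tcount 3F v) 3F
≈-canonical (1F ∷ v) = ∷-cong 1F (≈-canonical v)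
≈-canonical (2F ∷ v) =
  ≈-trans (∷-cong 2F (≈-canonical v))
  (≈-trans (∷-++ 2F ones _) (++-congˡ ones
  (≈-trans (∷-++ 2F threes _) (++-congˡ threes (∷-++ 2F zeros _)))))
  where
  ones : Z4Vec (tcount 1F v)
  ones = replicate (tcount 1F v) 1F
  threes : Z4Vec (tcount 3F v)
  threes = replicate (tcount 3F v) 3F
  zeros : Z4Vec (tcount 0F v)
  zeros = replicate (tcount 0F v) 0F
≈-canonical (3F ∷ v) = ≈-trans (∷-cong 3F (≈-canonical v)) (∷-++ 3F (replicate (tcount 1F v) 1F) _)

HasType⇒tcounts : ∀ {n t₀ t₁ t₂ t₃} (v : Z4Vec n) → HasType v t₀ t₁ t₂ t₃ →
                  tcount 0F v ≡ t₀ × tcount 1F v ≡ t₁ × tcount 2F v ≡ t₂ × tcount 3F v ≡ t₃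
HasType⇒tcounts {t₀ = t₀} {t₁} {t₂} {t₃} v h =
  ≡ᵇ-true (∧-conicalˡ b₀ _ h) , ≡ᵇ-true (∧-conicalˡ b₁ _ h₁) ,
  ≡ᵇ-true (∧-conicalˡ b₂ b₃ h₂) , ≡ᵇ-true (∧-conicalʳ b₂ b₃ h₂)
  where
  b₀ b₁ b₂ b₃ : Bool
  b₀ = tcount 0F v ≡ᵇ t₀
  b₁ = tcount 1F v ≡ᵇ t₁
  b₂ = tcount 2F v ≡ᵇ t₂
  b₃ = tcount 3F v ≡ᵇ t₃
  h₁ : b₁ ∧ b₂ ∧ b₃ ≡ true
  h₁ = ∧-conicalʳ b₀ _ h
  h₂ : b₂ ∧ b₃ ≡ true
  h₂ = ∧-conicalʳ b₁ _ h₁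
  ≡ᵇ-true : ∀ {m n} → (m ≡ᵇ n) ≡ true → m ≡ n
  ≡ᵇ-true {m} {n} e = ℕP.≡ᵇ⇒≡ m n (subst T (sym e) tt)

HasType-≈ : ∀ {n t₀ t₁ t₂ t₃} (v : Z4Vec n) → HasType v t₀ t₁ t₂ t₃ → v ≈ canonical t₀ t₁ t₂ t₃
HasType-≈ v h with HasType⇒tcounts v h
... | refl , refl , refl , refl = ≈-canonical v

-- The vector 1 3 2 ⋯ 2

-- Removing one a from c lowers weight c by a, so ζ₄^(2 weight) passes through peel at
-- the cost of a factor ζ₄^(2a).
peel-twist : ∀ {n} x a (g : Vec ℕ n → GInt) c →
  rot^ (toℕ a * x) (peel 0ᴳ a (λ c' → rot^ (2 * weight c') (g c')) c)
    ≡ rot^ (2 * weight c) (rot^ (toℕ a * (x + 2)) (peel 0ᴳ a g c))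
peel-twist x a g c with lookup c a in c[a]≡
... | zero  = trans (rot^-0ᴳ (toℕ a * x))
                    (sym (trans (cong (rot^ (2 * weight c)) (rot^-0ᴳ (toℕ a * (x + 2)))) (rot^-0ᴳ _)))
... | suc _ = begin
  rot^ (toℕ a * x) (rot^ (2 * weight c') (g c'))
    ≡⟨ rot^-+ (toℕ a * x) (2 * weight c') (g c') ⟨
  rot^ (toℕ a * x + 2 * weight c') (g c')
    ≡⟨ rot^-*4 (toℕ a) _ ⟨
  rot^ (toℕ a * 4) (rot^ (toℕ a * x + 2 * weight c') (g c'))
    ≡⟨ rot^-+ (toℕ a * 4) _ (g c') ⟨
  rot^ (toℕ a * 4 + (toℕ a * x + 2 * weight c')) (g c')
    ≡⟨ cong (λ e → rot^ e (g c')) (exponent (toℕ a) x (weight c')) ⟩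
  rot^ (2 * (toℕ a + weight c') + toℕ a * (x + 2)) (g c')
    ≡⟨ cong (λ w → rot^ (2 * w + toℕ a * (x + 2)) (g c')) (weight-remove a c c[a]≡) ⟩
  rot^ (2 * weight c + toℕ a * (x + 2)) (g c')
    ≡⟨ rot^-+ (2 * weight c) (toℕ a * (x + 2)) (g c') ⟩
  rot^ (2 * weight c) (rot^ (toℕ a * (x + 2)) (g c')) ∎
  where
  c' = remove a c
  exponent : ∀ a x w → a * 4 + (a * x + 2 * w) ≡ 2 * (a + w) + a * (x + 2)
  exponent = solve-∀

charSum-∷-twisted : ∀ {n} x (v : Z4Vec n) (H : Counts → GInt) →
  (∀ c → charSum v c ≡ rot^ (2 * weight c) (H c)) →
  ∀ c → charSum (x ∷ v) c
          ≡ rot^ (2 * weight c) (Σᴳ.sum (λ a → rot^ (toℕ a * (toℕ x + 2)) (peel 0ᴳ a H c)))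
charSum-∷-twisted x v H v≡ c = begin
  charSum (x ∷ v) c
    ≡⟨ charSum-∷ x v c ⟩
  Σᴳ.sum (λ a → rot^ (toℕ a * toℕ x) (peel 0ᴳ a (charSum v) c))
    ≡⟨ Σᴳ.sum-cong-≗ (λ a → cong (rot^ (toℕ a * toℕ x)) (peel-cong 0ᴳ a v≡ c)) ⟩
  Σᴳ.sum (λ a → rot^ (toℕ a * toℕ x) (peel 0ᴳ a (λ c' → rot^ (2 * weight c') (H c')) c))
    ≡⟨ Σᴳ.sum-cong-≗ (λ a → peel-twist (toℕ x) a H c) ⟩
  Σᴳ.sum (λ a → rot^ (2 * weight c) (rot^ (toℕ a * (toℕ x + 2)) (peel 0ᴳ a H c)))
    ≡⟨ rot^-sum (2 * weight c) (λ a → rot^ (toℕ a * (toℕ x + 2)) (peel 0ᴳ a H c)) ⟨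
  rot^ (2 * weight c) (Σᴳ.sum (λ a → rot^ (toℕ a * (toℕ x + 2)) (peel 0ᴳ a H c))) ∎

peel-real : ∀ {n} y (g : Vec ℕ n → ℕ) c → peel 0ᴳ y (real ∘ g) c ≡ real (peel 0 y g c)
peel-real y g c = sym (peel-natural real 0 y g c)

charSum-2ᵏ : ∀ k c → charSum (replicate k 2F) c ≡ rot^ (2 * weight c) (real (multinomial k c))
charSum-2ᵏ zero    (zero  ∷ zero  ∷ zero  ∷ zero  ∷ []) = refl
charSum-2ᵏ zero c@(suc _ ∷ _     ∷ _     ∷ _     ∷ []) = sym (rot^-0ᴳ (2 * weight c))
charSum-2ᵏ zero c@(zero  ∷ suc _ ∷ _     ∷ _     ∷ []) = sym (rot^-0ᴳ (2 * weight c))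
charSum-2ᵏ zero c@(zero  ∷ zero  ∷ suc _ ∷ _     ∷ []) = sym (rot^-0ᴳ (2 * weight c))
charSum-2ᵏ zero c@(zero  ∷ zero  ∷ zero  ∷ suc _ ∷ []) = sym (rot^-0ᴳ (2 * weight c))
charSum-2ᵏ (suc k) c = begin
  charSum (2F ∷ replicate k 2F) c
    ≡⟨ charSum-∷-twisted 2F (replicate k 2F) (real ∘ multinomial k) (charSum-2ᵏ k) c ⟩
  rot^ (2 * weight c) (Σᴳ.sum (λ a → rot^ (toℕ a * 4) (peel 0ᴳ a (real ∘ multinomial k) c)))
    ≡⟨ cong (rot^ (2 * weight c)) (Σᴳ.sum-cong-≗ λ a →
         trans (rot^-*4 (toℕ a) _) (peel-real a (multinomial k) c)) ⟩
  rot^ (2 * weight c) (Σᴳ.sum (λ a → real (peel 0 a (multinomial k) c)))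
    ≡⟨⟩
  rot^ (2 * weight c) (real (multinomial (suc k) c)) ∎

charSum-1∷3∷2ᵏ : ∀ k c → charSum (1F ∷ 3F ∷ replicate k 2F) c ≡ rot^ (2 * weight c)
  (Σᴳ.sum (λ a → Σᴳ.sum (λ b → (+ peel 0 a (peel 0 b (multinomial k)) c) ·ζ^ (toℕ a * 3 + toℕ b * 5))))
charSum-1∷3∷2ᵏ k c = begin
  charSum (1F ∷ 3F ∷ replicate k 2F) c
    ≡⟨ charSum-∷-twisted 1F (3F ∷ replicate k 2F) H
                         (charSum-∷-twisted 3F (replicate k 2F) (real ∘ multinomial k) (charSum-2ᵏ k)) c ⟩
  rot^ (2 * weight c) (Σᴳ.sum (λ a → rot^ (toℕ a * 3) (peel 0ᴳ a H c)))
    ≡⟨ cong (rot^ (2 * weight c))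
            (double-peel (λ a → toℕ a * 3) (λ b → toℕ b * 5) (real ∘ multinomial k) c) ⟩
  rot^ (2 * weight c) (Σᴳ.sum (λ a → Σᴳ.sum (λ b →
    rot^ (toℕ a * 3) (rot^ (toℕ b * 5) (peel 0ᴳ a (peel 0ᴳ b (real ∘ multinomial k)) c)))))
    ≡⟨ cong (rot^ (2 * weight c)) (Σᴳ.sum-cong-≗ λ a → Σᴳ.sum-cong-≗ λ b → term a b) ⟩
  rot^ (2 * weight c)
    (Σᴳ.sum (λ a → Σᴳ.sum (λ b → (+ peel 0 a (peel 0 b (multinomial k)) c) ·ζ^ (toℕ a * 3 + toℕ b * 5)))) ∎
  where
  H : Counts → GInt
  H c' = Σᴳ.sum (λ b → rot^ (toℕ b * 5) (peel 0ᴳ b (real ∘ multinomial k) c'))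
  term : ∀ a b → rot^ (toℕ a * 3) (rot^ (toℕ b * 5) (peel 0ᴳ a (peel 0ᴳ b (real ∘ multinomial k)) c))
                 ≡ (+ peel 0 a (peel 0 b (multinomial k)) c) ·ζ^ (toℕ a * 3 + toℕ b * 5)
  term a b = begin
    rot^ (toℕ a * 3) (rot^ (toℕ b * 5) (peel 0ᴳ a (peel 0ᴳ b (real ∘ multinomial k)) c))
      ≡⟨ rot^-+ (toℕ a * 3) (toℕ b * 5) _ ⟨
    rot^ (toℕ a * 3 + toℕ b * 5) (peel 0ᴳ a (peel 0ᴳ b (real ∘ multinomial k)) c)
      ≡⟨ cong (rot^ (toℕ a * 3 + toℕ b * 5))
              (trans (peel-cong 0ᴳ a (peel-real b (multinomial k)) c)
                     (peel-real a (peel 0 b (multinomial k)) c)) ⟩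
    rot^ (toℕ a * 3 + toℕ b * 5) (real (peel 0 a (peel 0 b (multinomial k)) c))
      ≡⟨ rot^-real (toℕ a * 3 + toℕ b * 5) _ ⟩
    (+ peel 0 a (peel 0 b (multinomial k)) c) ·ζ^ (toℕ a * 3 + toℕ b * 5) ∎

Σ²-·ζ^ : ∀ (x : Fin 4 → Fin 4 → ℤ) →
  Σᴳ.sum (λ a → Σᴳ.sum (λ b → x a b ·ζ^ (toℕ a * 3 + toℕ b * 5)))
    ≡ ( (x 0F 0F ℤ.+ (x 1F 1F ℤ.+ (x 2F 2F ℤ.+ x 3F 3F)))
          ℤ.- (x 0F 2F ℤ.+ (x 1F 3F ℤ.+ (x 2F 0F ℤ.+ x 3F 1F)))
      , (x 0F 1F ℤ.+ (x 1F 2F ℤ.+ (x 2F 3F ℤ.+ x 3F 0F)))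
          ℤ.- (x 1F 0F ℤ.+ (x 2F 1F ℤ.+ (x 3F 2F ℤ.+ x 0F 3F))))
Σ²-·ζ^ x =
  cong₂ _,_ (re (x 0F 0F) (x 0F 2F) (x 1F 1F) (x 1F 3F) (x 2F 0F) (x 2F 2F) (x 3F 1F) (x 3F 3F))
            (im (x 0F 1F) (x 0F 3F) (x 1F 0F) (x 1F 2F) (x 2F 1F) (x 2F 3F) (x 3F 0F) (x 3F 2F))
  where
  -- the left-hand sides are the two components of the double sum as they compute
  re : ∀ x₀₀ x₀₂ x₁₁ x₁₃ x₂₀ x₂₂ x₃₁ x₃₃ →
    (x₀₀ ℤ.+ (+ 0 ℤ.+ (ℤ.- x₀₂ ℤ.+ (+ 0 ℤ.+ + 0))))
      ℤ.+ ((+ 0 ℤ.+ (x₁₁ ℤ.+ (+ 0 ℤ.+ (ℤ.- x₁₃ ℤ.+ + 0))))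
      ℤ.+ ((ℤ.- x₂₀ ℤ.+ (+ 0 ℤ.+ (x₂₂ ℤ.+ (+ 0 ℤ.+ + 0))))
      ℤ.+ ((+ 0 ℤ.+ (ℤ.- x₃₁ ℤ.+ (+ 0 ℤ.+ (x₃₃ ℤ.+ + 0)))) ℤ.+ + 0)))
    ≡ (x₀₀ ℤ.+ (x₁₁ ℤ.+ (x₂₂ ℤ.+ x₃₃))) ℤ.- (x₀₂ ℤ.+ (x₁₃ ℤ.+ (x₂₀ ℤ.+ x₃₁)))
  re = ℤSolver.solve-∀
  im : ∀ x₀₁ x₀₃ x₁₀ x₁₂ x₂₁ x₂₃ x₃₀ x₃₂ →
    (+ 0 ℤ.+ (x₀₁ ℤ.+ (+ 0 ℤ.+ (ℤ.- x₀₃ ℤ.+ + 0))))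
      ℤ.+ ((ℤ.- x₁₀ ℤ.+ (+ 0 ℤ.+ (x₁₂ ℤ.+ (+ 0 ℤ.+ + 0))))
      ℤ.+ ((+ 0 ℤ.+ (ℤ.- x₂₁ ℤ.+ (+ 0 ℤ.+ (x₂₃ ℤ.+ + 0))))
      ℤ.+ ((x₃₀ ℤ.+ (+ 0 ℤ.+ (ℤ.- x₃₂ ℤ.+ (+ 0 ℤ.+ + 0)))) ℤ.+ + 0)))
    ≡ (x₀₁ ℤ.+ (x₁₂ ℤ.+ (x₂₃ ℤ.+ x₃₀))) ℤ.- (x₁₀ ℤ.+ (x₂₁ ℤ.+ (x₃₂ ℤ.+ x₀₃)))
  im = ℤSolver.solve-∀

-- In the next three lemmas `computed` restates the goal with the left-hand side unfolded,
-- since the ring solver reads the syntax of its goal.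
size-rsrs : ∀ r s → size (r ∷ s ∷ r ∷ s ∷ []) ≡ 2 * (r + s)
size-rsrs r s = computed r s
  where
  computed : ∀ r s → r + (s + (r + (s + 0))) ≡ 2 * (r + s)
  computed = solve-∀

weight-rsrs : ∀ r s → 2 * weight (r ∷ s ∷ r ∷ s ∷ []) ≡ (r + 2 * s) * 4
weight-rsrs r s = computed r s
  where
  computed : ∀ r s → 2 * ((s + (r + (s + 0))) + ((r + (s + 0)) + ((s + 0) + 0))) ≡ (r + 2 * s) * 4
  computed = solve-∀

∏!-rsrs : ∀ r s → ∏! (r ∷ s ∷ r ∷ s ∷ []) ≡ r ! * r ! * s ! * s !
∏!-rsrs r s = computed (r !) (s !)
  where
  computed : ∀ a b → a * (b * (a * (b * 1))) ≡ a * a * b * b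
  computed = solve-∀

difference-scaled : ∀ a b p e → b * p ≡ a * p + e → (+ a ℤ.- + b) ℤ.* + p ≡ - + e
difference-scaled a b p e b*p≡ = begin
  (+ a ℤ.- + b) ℤ.* + p              ≡⟨ distribʳ (+ a) (+ b) (+ p) ⟩
  + a ℤ.* + p ℤ.- + b ℤ.* + p        ≡⟨ cong₂ (λ x y → x ℤ.- y) (ℤP.pos-* a p) (ℤP.pos-* b p) ⟨
  + (a * p) ℤ.- + (b * p)            ≡⟨ cong (λ y → + (a * p) ℤ.- y)
                                              (trans (cong +_ b*p≡) (ℤP.pos-+ (a * p) e)) ⟩
  + (a * p) ℤ.- (+ (a * p) ℤ.+ + e)  ≡⟨ cancel (+ (a * p)) (+ e) ⟩
  - + e                              ∎
  where
  distribʳ : ∀ x y p → (x ℤ.- y) ℤ.* p ≡ x ℤ.* p ℤ.- y ℤ.* p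
  distribʳ = ℤSolver.solve-∀
  cancel : ∀ x y → x ℤ.- (x ℤ.+ y) ≡ - y
  cancel = ℤSolver.solve-∀

module _ (r s k : ℕ) where

  private
    c : Counts
    c = r ∷ s ∷ r ∷ s ∷ []

    d : Fin 4 → Fin 4 → ℕ
    d a b = peel 0 a (peel 0 b (multinomial k)) c

    diagonal antidiagonal superdiagonal subdiagonal : ℕ
    diagonal      = d 0F 0F + (d 1F 1F + (d 2F 2F + d 3F 3F))
    antidiagonal  = d 0F 2F + (d 1F 3F + (d 2F 0F + d 3F 1F))
    superdiagonal = d 0F 1F + (d 1F 2F + (d 2F 3F + d 3F 0F))
    subdiagonal   = d 1F 0F + (d 2F 1F + (d 3F 2F + d 0F 3F))

  charSum-1∷3∷2ᵏ-rsrs : charSum (1F ∷ 3F ∷ replicate k 2F) c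
                          ≡ (+ diagonal ℤ.- + antidiagonal , + superdiagonal ℤ.- + subdiagonal)
  charSum-1∷3∷2ᵏ-rsrs = begin
    charSum (1F ∷ 3F ∷ replicate k 2F) c  ≡⟨ charSum-1∷3∷2ᵏ k c ⟩
    rot^ (2 * weight c) double-sum        ≡⟨ cong (λ e → rot^ e double-sum) (weight-rsrs r s) ⟩
    rot^ ((r + 2 * s) * 4) double-sum     ≡⟨ rot^-*4 (r + 2 * s) double-sum ⟩
    double-sum                            ≡⟨ Σ²-·ζ^ (λ a b → + d a b) ⟩
    (+ diagonal ℤ.- + antidiagonal , + superdiagonal ℤ.- + subdiagonal) ∎
    where
    double-sum : GInt
    double-sum = Σᴳ.sum (λ a → Σᴳ.sum (λ b → (+ d a b) ·ζ^ (toℕ a * 3 + toℕ b * 5)))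

  superdiagonal≡subdiagonal : superdiagonal ≡ subdiagonal
  superdiagonal≡subdiagonal =
    cong₂ _+_ (symmetric 0F 1F) (cong₂ _+_ (symmetric 1F 2F) (cong₂ _+_ (symmetric 2F 3F) (symmetric 3F 0F)))
    where
    symmetric : ∀ a b → d a b ≡ d b a
    symmetric a b = peel-comm 0 a b (multinomial k) c

  antidiagonal-∏! : size c ≡ 2 + k → antidiagonal * ∏! c ≡ diagonal * ∏! c + size c * k !
  antidiagonal-∏! size≡ = begin
    antidiagonal * ∏! c
      ≡⟨ distrib (d 0F 2F) (d 1F 3F) (d 2F 0F) (d 3F 1F) (∏! c) ⟩
    d 0F 2F * ∏! c + (d 1F 3F * ∏! c + (d 2F 0F * ∏! c + d 3F 1F * ∏! c))
      ≡⟨ cong₂ _+_ (fact 0F 2F) (cong₂ _+_ (fact 1F 3F) (cong₂ _+_ (fact 2F 0F) (fact 3F 1F))) ⟩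
    r * (r * F) + (s * (s * F) + (r * (r * F) + s * (s * F)))
      ≡⟨ cong₂ _+_ (square r) (cong₂ _+_ (square s) (cong₂ _+_ (square r) (square s))) ⟩
    (r * (pred r * F) + r * F) + ((s * (pred s * F) + s * F)
      + ((r * (pred r * F) + r * F) + (s * (pred s * F) + s * F)))
      ≡⟨ collect (r * (pred r * F)) (s * (pred s * F)) r s F ⟩
    (r * (pred r * F) + (s * (pred s * F) + (r * (pred r * F) + s * (pred s * F))))
      + size c * F
      ≡⟨ cong (_+ size c * F)
              (cong₂ _+_ (fact 0F 0F) (cong₂ _+_ (fact 1F 1F) (cong₂ _+_ (fact 2F 2F) (fact 3F 3F)))) ⟨
    (d 0F 0F * ∏! c + (d 1F 1F * ∏! c + (d 2F 2F * ∏! c + d 3F 3F * ∏! c))) + size c * F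
      ≡⟨ cong (_+ size c * F) (distrib (d 0F 0F) (d 1F 1F) (d 2F 2F) (d 3F 3F) (∏! c)) ⟨
    diagonal * ∏! c + size c * F ∎
    where
    F : ℕ
    F = k !
    fact : ∀ a b → d a b * ∏! c ≡ lookup c a * (lookup (remove a c) b * F)
    fact a b = peel-∏! {g = peel 0 b (multinomial k)}
                       (λ c′ → peel-∏! {g = multinomial k} (multinomial-! k) b c′) a c size≡
    distrib : ∀ a b c d p → (a + (b + (c + d))) * p ≡ a * p + (b * p + (c * p + d * p))
    distrib = solve-∀
    square : ∀ m → m * (m * F) ≡ m * (pred m * F) + m * F
    square zero    = refl
    square (suc m) = expand m F
      where
      expand : ∀ m F → suc m * (suc m * F) ≡ suc m * (m * F) + suc m * F
      expand = solve-∀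
    collect : ∀ u w r s F → (u + r * F) + ((w + s * F) + ((u + r * F) + (w + s * F)))
                            ≡ (u + (w + (u + w))) + (r + (s + (r + (s + 0)))) * F
    collect = solve-∀

  charSum-1∷3∷2ᵏ-im : proj₂ (charSum (1F ∷ 3F ∷ replicate k 2F) c) ≡ + 0
  charSum-1∷3∷2ᵏ-im = begin
    proj₂ (charSum (1F ∷ 3F ∷ replicate k 2F) c)
      ≡⟨ cong proj₂ charSum-1∷3∷2ᵏ-rsrs ⟩
    + superdiagonal ℤ.- + subdiagonal
      ≡⟨ cong (λ x → + superdiagonal ℤ.- + x) superdiagonal≡subdiagonal ⟨
    + superdiagonal ℤ.- + superdiagonal
      ≡⟨ ℤP.+-inverseʳ (+ superdiagonal) ⟩
    + 0 ∎

  charSum-1∷3∷2ᵏ-re : size c ≡ 2 + k →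
                      proj₁ (charSum (1F ∷ 3F ∷ replicate k 2F) c) ℤ.* + ∏! c ≡ - + (size c * k !)
  charSum-1∷3∷2ᵏ-re size≡ =
    trans (cong (λ z → proj₁ z ℤ.* + ∏! c) charSum-1∷3∷2ᵏ-rsrs)
          (difference-scaled diagonal antidiagonal (∏! c) (size c * k !) (antidiagonal-∏! size≡))

scale-to-factorial : ∀ n k x p → n ≡ 2 + k → x ℤ.* + p ≡ - + (n * k !) →
                     (+ (n ∸ 1) ℤ.* x) ℤ.* + p ≡ - + (n !)
scale-to-factorial .(2 + k) k x p refl x*p≡ = begin
  (+ suc k ℤ.* x) ℤ.* + p            ≡⟨ ℤP.*-assoc (+ suc k) x (+ p) ⟩
  + suc k ℤ.* (x ℤ.* + p)            ≡⟨ cong (+ suc k ℤ.*_) x*p≡ ⟩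
  + suc k ℤ.* - + ((2 + k) * k !)    ≡⟨ ℤP.neg-distribʳ-* (+ suc k) _ ⟨
  - (+ suc k ℤ.* + ((2 + k) * k !))  ≡⟨ cong -_ (ℤP.pos-* (suc k) _) ⟨
  - + (suc k * ((2 + k) * k !))      ≡⟨ cong (-_ ∘ +_) (x∙yz≈y∙xz (suc k) (2 + k) (k !)) ⟩
  - + ((2 + k) !)                    ∎

lemma7 : (r s : ℕ) → s ≤ r → 1 ≤ r →
    let n = 2 * (r + s) in
    (v : Z4Vec n) → HasType v 0 1 (n ∸ 2) 1 →
    (proj₂ (eigen r s v) ≡ + 0)
      × (((+ (n ∸ 1)) ℤ.* proj₁ (eigen r s v)) ℤ.* (+ (r ! * r ! * s ! * s !))
          ≡ - (+ (n !)))
lemma7 r s _ 1≤r v h =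
    trans (cong proj₂ eigen≡) (charSum-1∷3∷2ᵏ-im r s k)
  , scale-to-factorial n k _ _ n≡2+k (begin
      proj₁ (eigen r s v) ℤ.* + (r ! * r ! * s ! * s !)
        ≡⟨ cong₂ (λ z p → proj₁ z ℤ.* + p) eigen≡ (sym (∏!-rsrs r s)) ⟩
      proj₁ (charSum (1F ∷ 3F ∷ replicate k 2F) c) ℤ.* + ∏! c
        ≡⟨ charSum-1∷3∷2ᵏ-re r s k (trans (size-rsrs r s) n≡2+k) ⟩
      - + (size c * k !)
        ≡⟨ cong (λ m → - + (m * k !)) (size-rsrs r s) ⟩
      - + (n * k !) ∎)
  where
  n k : ℕ
  n = 2 * (r + s)
  k = n ∸ 2
  c : Counts
  c = r ∷ s ∷ r ∷ s ∷ []
  n≡2+k : n ≡ 2 + k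
  n≡2+k = sym (ℕP.m+[n∸m]≡n (ℕP.*-monoʳ-≤ 2 (ℕP.≤-trans 1≤r (ℕP.m≤m+n r s))))
  eigen≡ : eigen r s v ≡ charSum (1F ∷ 3F ∷ replicate k 2F) c
  eigen≡ = charSum-≡ (HasType-≈ v h) c
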